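{- Let $G$ be a finite group acting on a finite set $X$, $H$ a subgroup of $G$, $E$ an equivalence relation on $X$ and $d\in\mathbb{N}$. If $(H,X)$ has the $(E,d)$-UHJP, then for every $n,r\in\mathbb{N}$ there exists a positive integer $N=N(n,r)$ such that for any $r$-coloring of $X^N$ there exists a sequence $(W_i)_{i=1}^n$ in $\mathrm{V}^d_{\mathrm{un}}(H;X)$ with $\sum_{i=1}^n|W_i|=N$ such that for every $(x_i)_{i=1}^n\in X^n$ the set $\{W_1(x_1')^\frown W_2(x_2')^\frown\cdots^\frown W_n(x_n'):\ x_i'Ex_i\text{ for all }i\in[n]\}$ is monochromatic.
   Context: $[n]=\{1,\dots,n\}$; an $r$-coloring of $Y$ is a map $Y\to[r]$; monochromatic means the coloring is constant; $^\frown$ denotes concatenation of finite sequences and $|W|$ the length of a word $W$. Fix distinct variables $\{v_g:g\in G\}$ not in $X$. For nonempty $H\subseteq G$, an $H$-variable word over $X$ of length $N$ is $W=(w_i)_{i=1}^N$ with $w_i\in X\cup\{v_h:h\in H\}$ and each $F_h=\{i:w_i=v_h\}$, $h\in H$, nonempty; degree $=\sum_{h\in H}|F_h|$; uniform if all $|F_h|$ are equal. For $x\in X$, $W(x)\in X^N$ replaces each $v_h$ by $hx$ (the action). $\mathrm{V}^d_{\mathrm{un}}(H;X)$ denotes the uniform $H$-variable words over $X$ of degree $d$. $(H,X)$ has the $(E,d)$-UHJP if for every $r\in\mathbb{N}$ there is $N$ such that for every $r$-coloring of $X^N$ there is $W\in\mathrm{V}^d_{\mathrm{un}}(H;X)$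 of length $N$ such that for every $x\in X$ the set $\{W(x'):x'Ex\}$ is monochromatic. -}

module Defs where

open import Level using (0ℓ)
open import Data.Nat using (ℕ; zero; suc; _+_; _≤_)
open import Data.Fin using (Fin)
open import Data.Fin.Subset using (Subset; _∈_)
open import Data.Sum using (_⊎_; inj₁; inj₂; [_,_])
open import Data.Product using (Σ; ∃; _×_; _,_; proj₁; proj₂)
open import Data.Vec using (Vec; []; _∷_; _++_; map)
open import Relation.Binary.PropositionalEquality using (_≡_; subst)
open import Relation.Binary using (Rel; IsEquivalence)
open import Algebra.Structures using (IsGroup)
import Data.Fin
import Relation.Nullary
import Data.Unit

-- A finite group G, represented (up to isomorphism) with carrier Fin m,
-- acting on a finite set X, represented with carrier Fin k.
record GroupAction (m k : ℕ) : Set where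
  field
    _∙_     : Fin m → Fin m → Fin m
    ε       : Fin m
    _⁻¹     : Fin m → Fin m
    isGroup : IsGroup _≡_ _∙_ ε _⁻¹
    act     : Fin m → Fin k → Fin k
    act-ε   : ∀ x → act ε x ≡ x
    act-∙   : ∀ g h x → act (g ∙ h) x ≡ act g (act h x)

module _ {m k : ℕ} (A : GroupAction m k) where
  open GroupAction A

  record IsSubgroup (H : Subset m) : Set where
    field
      ε∈H  : ε ∈ H
      ∙∈H  : ∀ {g h} → g ∈ H → h ∈ H → (g ∙ h) ∈ H
      ⁻¹∈H : ∀ {g} → g ∈ H → (g ⁻¹) ∈ H

  -- Letters of variable words: inj₁ x is the constant x ∈ X,
  -- inj₂ g is the variable v_g.
  Letter : Set
  Letter = Fin k ⊎ Fin m

  count : ∀ {N} → Fin m → Vec Letter N → ℕ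
  count g [] = 0
  count g (inj₁ x ∷ W) = count g W
  count g (inj₂ h ∷ W) with g Data.Fin.≟ h
  ... | Relation.Nullary.yes _ = suc (count g W)
  ... | Relation.Nullary.no  _ = count g W

  -- number of variable positions, i.e. Σ_{h∈H} |F_h| (all variables lie in H)
  varCount : ∀ {N} → Vec Letter N → ℕ
  varCount [] = 0
  varCount (inj₁ x ∷ W) = varCount W
  varCount (inj₂ h ∷ W) = suc (varCount W)

  data VarsIn (H : Subset m) : ∀ {N} → Vec Letter N → Set where
    []   : VarsIn H []
    con  : ∀ {N x} {W : Vec Letter N} → VarsIn H W → VarsIn H (inj₁ x ∷ W)
    var  : ∀ {N h} {W : Vec Letter N} → h ∈ H → VarsIn H W → VarsIn H (inj₂ h ∷ W)

  record IsUnifVarWord (H : Subset m) (d : ℕ) {N : ℕ} (W : Vec Letter N) : Set where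
    field
      varsIn   : VarsIn H W
      nonempty : ∀ h → h ∈ H → 1 ≤ count h W
      uniform  : ∀ h h' → h ∈ H → h' ∈ H → count h W ≡ count h' W
      degree   : varCount W ≡ d

  subst-word : ∀ {N} → Vec Letter N → Fin k → Vec (Fin k) N
  subst-word W x = map [ (λ y → y) , (λ g → act g x) ] W

  UHJP : (H : Subset m) (E : Rel (Fin k) 0ℓ) (d : ℕ) → Set
  UHJP H E d =
    ∀ r → 1 ≤ r → Σ ℕ λ N → ∀ (c : Vec (Fin k) N → Fin r) →
      Σ (Vec Letter N) λ W → IsUnifVarWord H d W ×
        (∀ x x' x'' → E x' x → E x'' x → c (subst-word W x') ≡ c (subst-word W x''))

  Words : ℕ → Set
  Words n = Vec (Σ ℕ λ L → Vec Letter L) n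

  totalLength : ∀ {n} → Words n → ℕ
  totalLength [] = 0
  totalLength ((L , _) ∷ Ws) = L + totalLength Ws

  AllUnif : (H : Subset m) (d : ℕ) → ∀ {n} → Words n → Set
  AllUnif H d [] = Data.Unit.⊤
  AllUnif H d ((L , W) ∷ Ws) = IsUnifVarWord H d W × AllUnif H d Ws

  concatSubst : ∀ {n} (Ws : Words n) → Vec (Fin k) n → Vec (Fin k) (totalLength Ws)
  concatSubst [] [] = []
  concatSubst ((L , W) ∷ Ws) (x ∷ xs) = subst-word W x ++ concatSubst Ws xs

  PointwiseE : (E : Rel (Fin k) 0ℓ) → ∀ {n} → Vec (Fin k) n → Vec (Fin k) n → Set
  PointwiseE E [] [] = Data.Unit.⊤
  PointwiseE E (y ∷ ys) (x ∷ xs) = E y x × PointwiseE E ys xs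

-- To handle n + 1 blocks, first colour each tail t ∈ X^N' by the whole
-- function a ↦ c (a ⁀ t) on the first block (finitely many colours), and find tail words
-- W₂ … W_{n+1} by induction. Then colour each a ∈ X^N₀ by the function
-- (x₂ … x_{n+1}) ↦ c (a ⁀ W₂(x₂) ⁀ … ⁀ W_{n+1}(x_{n+1})), again with finitely many
-- colours, and pick W₁ by the UHJP. Changing x₁ within its E-class, and then the tail
-- within its E-classes, each leaves the colour unchanged.
module Submission where

open import Defs
open import Level using (0ℓ)
open import Data.Nat using (ℕ; zero; suc; _+_; _^_; _≤_; s≤s; z≤n; >-nonZero)
open import Data.Nat.Properties using (m^n>0; ≤-trans; m≤m+n)
open import Data.Fin using (Fin; funToFin; finToFun)
open import Data.Fin.Properties using (finToFun-funToFin)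
open import Data.Fin.Subset using (Subset)
open import Data.Product using (Σ; _×_; _,_; proj₁; proj₂)
open import Data.Unit using (tt)
open import Data.Vec using (Vec; []; _∷_; _++_; lookup; tabulate)
open import Data.Vec.Properties using (tabulate∘lookup; tabulate-cong)
open import Relation.Binary using (Rel; IsEquivalence)
open import Relation.Binary.PropositionalEquality
  using (_≡_; refl; sym; trans; cong; subst; module ≡-Reasoning)

module _ {k : ℕ} where

  encodeVec : ∀ {L} → Vec (Fin k) L → Fin (k ^ L)
  encodeVec v = funToFin (lookup v)

  decodeVec : ∀ {L} → Fin (k ^ L) → Vec (Fin k) L
  decodeVec i = tabulate (finToFun i)

  decodeVec∘encodeVec : ∀ {L} (v : Vec (Fin k) L) → decodeVec (encodeVec v) ≡ v
  decodeVec∘encodeVec v =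
    trans (tabulate-cong (finToFun-funToFin (lookup v))) (tabulate∘lookup v)

  encodeColouring : ∀ {L r} → (Vec (Fin k) L → Fin r) → Fin (r ^ (k ^ L))
  encodeColouring c = funToFin (λ i → c (decodeVec i))

  encodeColouring-injective : ∀ {L r} (c c' : Vec (Fin k) L → Fin r) →
    encodeColouring c ≡ encodeColouring c' → ∀ v → c v ≡ c' v
  encodeColouring-injective c c' eq v = begin
    c v                                         ≡⟨ cong c (sym (decodeVec∘encodeVec v)) ⟩
    c (decodeVec (encodeVec v))                 ≡⟨ sym (finToFun-funToFin _ (encodeVec v)) ⟩
    finToFun (encodeColouring c) (encodeVec v)  ≡⟨ cong (λ j → finToFun j (encodeVec v)) eq ⟩
    finToFun (encodeColouring c') (encodeVec v) ≡⟨ finToFun-funToFin _ (encodeVec v) ⟩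
    c' (decodeVec (encodeVec v))                ≡⟨ cong c' (decodeVec∘encodeVec v) ⟩
    c' v                                        ∎
    where open ≡-Reasoning

subst-++ : ∀ {A : Set} {a b b'} (eq : b ≡ b') (xs : Vec A a) (ys : Vec A b) →
  subst (Vec A) (cong (a +_) eq) (xs ++ ys) ≡ xs ++ subst (Vec A) eq ys
subst-++ refl xs ys = refl

^-positive : ∀ {r} K → 1 ≤ r → 1 ≤ r ^ K
^-positive {r} K 1≤r = m^n>0 r {{>-nonZero 1≤r}} K

module _ {m k : ℕ} (A : GroupAction m k) where

  unifVarWord-length-positive : ∀ {H d L} {W : Vec (Letter A) L} →
    IsSubgroup A H → IsUnifVarWord A H d W → 1 ≤ L
  unifVarWord-length-positive {W = W} H≤G unif =
    nonempty⇒positive W (IsUnifVarWord.nonempty unif _ (IsSubgroup.ε∈H H≤G))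
    where
    nonempty⇒positive : ∀ {L g} (W : Vec (Letter A) L) → 1 ≤ count A g W → 1 ≤ L
    nonempty⇒positive (_ ∷ _) _ = s≤s z≤n

  totalLength-positive : ∀ {H d n} (Ws : Words A (suc n)) →
    IsSubgroup A H → AllUnif A H d Ws → 1 ≤ totalLength A Ws
  totalLength-positive ((L , W) ∷ Ws) H≤G (unif , _) =
    ≤-trans (unifVarWord-length-positive H≤G unif) (m≤m+n L (totalLength A Ws))

module _ {m k : ℕ} (A : GroupAction m k) (H : Subset m) (E : Rel (Fin k) 0ℓ) (d : ℕ) where

  UHJPWitness : (r N : ℕ) → Set
  UHJPWitness r N = ∀ (c : Vec (Fin k) N → Fin r) →
    Σ (Vec (Letter A) N) λ W → IsUnifVarWord A H d W ×
      (∀ x x' x'' → E x' x → E x'' x → c (subst-word A W x') ≡ c (subst-word A W x''))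

  ConcatMonochromatic : ∀ {n N r} → (Vec (Fin k) N → Fin r) →
    (Ws : Words A n) → totalLength A Ws ≡ N → Set
  ConcatMonochromatic {n} c Ws eq =
    ∀ (xs ys zs : Vec (Fin k) n) → PointwiseE A E ys xs → PointwiseE A E zs xs →
      c (subst (Vec (Fin k)) eq (concatSubst A Ws ys))
        ≡ c (subst (Vec (Fin k)) eq (concatSubst A Ws zs))

  BlockWitness : (n r N : ℕ) → Set
  BlockWitness n r N = ∀ (c : Vec (Fin k) N → Fin r) →
    Σ (Words A n) λ Ws → AllUnif A H d Ws ×
      Σ (totalLength A Ws ≡ N) λ eq → ConcatMonochromatic c Ws eq

  blockWitness-zero : ∀ r → BlockWitness 0 r 0
  blockWitness-zero r c = [] , tt , refl , λ { [] [] [] _ _ → refl }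

  blockWitness-suc : ∀ {n r N₀ N'} → UHJPWitness (r ^ (k ^ n)) N₀ →
    BlockWitness n (r ^ (k ^ N₀)) N' → BlockWitness (suc n) r (N₀ + N')
  blockWitness-suc {n} {r} {N₀} {N'} head tail c =
    ((N₀ , W₀) ∷ Ws') , (W₀-unif , Ws'-unif) , cong (N₀ +_) eq' , monochromatic
    where
    tailColouring : Vec (Fin k) N' → Fin (r ^ (k ^ N₀))
    tailColouring t = encodeColouring (λ a → c (a ++ t))

    Ws' = proj₁ (tail tailColouring)
    Ws'-unif = proj₁ (proj₂ (tail tailColouring))
    eq' = proj₁ (proj₂ (proj₂ (tail tailColouring)))
    Ws'-mono = proj₂ (proj₂ (proj₂ (tail tailColouring)))

    tailWord : Vec (Fin k) n → Vec (Fin k) N'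
    tailWord xs = subst (Vec (Fin k)) eq' (concatSubst A Ws' xs)

    headColouring : Vec (Fin k) N₀ → Fin (r ^ (k ^ n))
    headColouring a = encodeColouring (λ xs → c (a ++ tailWord xs))

    W₀ = proj₁ (head headColouring)
    W₀-unif = proj₁ (proj₂ (head headColouring))
    W₀-mono = proj₂ (proj₂ (head headColouring))

    monochromatic : ConcatMonochromatic c ((N₀ , W₀) ∷ Ws') (cong (N₀ +_) eq')
    monochromatic (x ∷ xs) (y ∷ ys) (z ∷ zs) (y~x , ys~xs) (z~x , zs~xs) = begin
      c (subst (Vec (Fin k)) (cong (N₀ +_) eq') (subst-word A W₀ y ++ concatSubst A Ws' ys))
        ≡⟨ cong c (subst-++ eq' (subst-word A W₀ y) (concatSubst A Ws' ys)) ⟩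
      c (subst-word A W₀ y ++ tailWord ys)
        ≡⟨ encodeColouring-injective _ _ (W₀-mono x y z y~x z~x) ys ⟩
      c (subst-word A W₀ z ++ tailWord ys)
        ≡⟨ encodeColouring-injective (λ a → c (a ++ tailWord ys)) (λ a → c (a ++ tailWord zs))
             (Ws'-mono xs ys zs ys~xs zs~xs) (subst-word A W₀ z) ⟩
      c (subst-word A W₀ z ++ tailWord zs)
        ≡⟨ sym (cong c (subst-++ eq' (subst-word A W₀ z) (concatSubst A Ws' zs))) ⟩
      c (subst (Vec (Fin k)) (cong (N₀ +_) eq') (subst-word A W₀ z ++ concatSubst A Ws' zs))
        ∎
      where open ≡-Reasoning

  blockWitness : UHJP A H E d → ∀ n r → 1 ≤ r → Σ ℕ (BlockWitness n r)
  blockWitness uhjp zero    r 1≤r = 0 , blockWitness-zero r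
  blockWitness uhjp (suc n) r 1≤r = N₀ + N' , blockWitness-suc head tail
    where
    N₀ = proj₁ (uhjp (r ^ (k ^ n)) (^-positive (k ^ n) 1≤r))
    head = proj₂ (uhjp (r ^ (k ^ n)) (^-positive (k ^ n) 1≤r))
    N' = proj₁ (blockWitness uhjp n (r ^ (k ^ N₀)) (^-positive (k ^ N₀) 1≤r))
    tail = proj₂ (blockWitness uhjp n (r ^ (k ^ N₀)) (^-positive (k ^ N₀) 1≤r))

  blockWitness-length-positive : ∀ {n r N} → IsSubgroup A H →
    BlockWitness (suc n) (suc r) N → 1 ≤ N
  blockWitness-length-positive H≤G blocks
    with blocks (λ _ → Fin.zero)
  ... | Ws , unif , refl , _ = totalLength-positive A Ws H≤G unif

-- E need not be an equivalence relation for this argument.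
lemma3p1 : ∀ {m k : ℕ} (A : GroupAction m k) (H : Subset m) → IsSubgroup A H →
    (E : Rel (Fin k) 0ℓ) → IsEquivalence E → (d : ℕ) → UHJP A H E d →
    ∀ n r → 1 ≤ n → 1 ≤ r →
      Σ ℕ λ N → 1 ≤ N × (∀ (c : Vec (Fin k) N → Fin r) →
        Σ (Words A n) λ Ws → AllUnif A H d Ws ×
          Σ (totalLength A Ws ≡ N) λ eq →
            ∀ (xs ys zs : Vec (Fin k) n) → PointwiseE A E ys xs → PointwiseE A E zs xs →
              c (subst (Vec (Fin k)) eq (concatSubst A Ws ys))
                ≡ c (subst (Vec (Fin k)) eq (concatSubst A Ws zs)))
lemma3p1 A H H≤G E _ d uhjp (suc n) (suc r) _ 1≤r =
  N , blockWitness-length-positive A H E d H≤G blocks , blocks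
  where
  N = proj₁ (blockWitness A H E d uhjp (suc n) (suc r) 1≤r)
  blocks = proj₂ (blockWitness A H E d uhjp (suc n) (suc r) 1≤r)
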